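{- Let $k$ be a positive integer and let $n$ be an integer with $k^2<n<k^2+k$. Then there is no coloring $\chi:[n]\times[n]\to[k]$ of the $n\times n$ grid that has no monochromatic rectangle and has the shift pattern.
   Context: Cells of the $n\times n$ grid are $(r,s)\in[n]\times[n]$ ($r$ the row, $s$ the column). A monochromatic rectangle is a set of four distinct cells $(a,b),(a,d),(c,b),(c,d)$ all of the same color. A coloring $\chi$ of the $n\times n$ grid has the shift pattern if every row is a cyclic shift of the first row, the $r$-th row being shifted by $r-1$ positions in a fixed direction (with wrap-around): i.e. either $\chi(r,s)=\chi(1,((s-r)\bmod n)+1)$ for all $r,s$ (right shift) or $\chi(r,s)=\chi(1,((s+r-2)\bmod n)+1)$ for all $r,s$ (left shift). -}

module Defs where

open import Data.Nat using (ℕ; zero; suc; _+_; _∸_; _%_)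
open import Data.Unit using (⊤)
open import Data.Fin using (Fin; toℕ)
open import Data.Sum using (_⊎_)
open import Data.Product using (∃-syntax; _×_)
open import Relation.Binary.PropositionalEquality using (_≡_; _≢_)

-- Cells of the n×n grid are indexed 0-based by Fin n × Fin n
-- (row r, column s); the paper's (r,s) ∈ [n]×[n] corresponds to (r-1, s-1),
-- and the paper's color set [k] corresponds to Fin k.
Coloring : ℕ → ℕ → Set
Coloring n k = Fin n → Fin n → Fin k

-- A monochromatic rectangle: four distinct cells (a,b),(a,d),(c,b),(c,d)
-- (the four cells are distinct iff a ≢ c and b ≢ d), all of the same color.
HasMonoRectangle : ∀ {n k} → Coloring n k → Set
HasMonoRectangle χ =
  ∃[ a ] ∃[ b ] ∃[ c ] ∃[ d ]
    (a ≢ c × b ≢ d × χ a b ≡ χ a d × χ a b ≡ χ c b × χ a b ≡ χ c d)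

-- Right shift, 0-based: χ(r,s) = χ(0, (s - r) mod n) for all r, s.
-- Here f is the first row (toℕ f ≡ 0) and j the column (s - r) mod n,
-- computed as (s + (n - r)) mod n in ℕ.
-- (For n = 0 the grid is empty and the condition is vacuous.)
RightShift : ∀ {n k} → Coloring n k → Set
RightShift {zero} χ = ⊤
RightShift {n@(suc _)} χ = ∀ (r s f j : Fin n) → toℕ f ≡ 0 →
  toℕ j ≡ (toℕ s + (n ∸ toℕ r)) % n → χ r s ≡ χ f j

LeftShift : ∀ {n k} → Coloring n k → Set
LeftShift {zero} χ = ⊤
LeftShift {n@(suc _)} χ = ∀ (r s f j : Fin n) → toℕ f ≡ 0 →
  toℕ j ≡ (toℕ s + toℕ r) % n → χ r s ≡ χ f j

HasShiftPattern : ∀ {n k} → Coloring n k → Set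
HasShiftPattern χ = RightShift χ ⊎ LeftShift χ

-- In a shift-pattern colouring every row is the first row with its columns
-- permuted, and any column of the first row can be carried to any other one
-- by some row. Since n > k², some colour α occupies k + 1 cells g₀, …, g_k of
-- the first row. For each of the k(k + 1) ordered pairs (p, q) with p ≢ q
-- choose a row carrying column g_p to column g_q; it is not the first row, so
-- as n − 1 < k(k + 1) two pairs share a row r. Both pairs must have distinct
-- first components (a row is a permutation), say p and p′, and then the
-- cells (0, g_p), (0, g_p′), (r, g_p), (r, g_p′) all have colour α.
module Submission where

open import Data.Empty using (⊥-elim)
open import Data.Fin using (Fin; zero; suc; toℕ; punchIn; punchOut; remQuot; combine; inject≤)
open import Data.Fin.Properties
  using (_≟_; toℕ-injective; toℕ-fromℕ<; toℕ<n; punchIn-injective; punchInᵢ≢i;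
         punchOut-injective; pigeonhole; combine-remQuot; <⇒≢; inject≤-injective)
open import Data.List using (List; []; _∷_; length; filter; lookup; allFin)
open import Data.List.Membership.Propositional using (_∈_)
open import Data.List.Membership.Propositional.Properties using (∈-lookup; ∈-allFin)
open import Data.List.Properties using (length-tabulate)
open import Data.List.Relation.Unary.All as All using (All; _∷_)
open import Data.List.Relation.Unary.All.Properties using (all-filter; filter⁺)
open import Data.List.Relation.Unary.AllPairs using (_∷_)
import Data.List.Relation.Unary.Any as Any
open import Data.List.Relation.Unary.Unique.Propositional using (Unique)
import Data.List.Relation.Unary.Unique.Propositional.Properties as Unique
open import Data.Nat using (ℕ; zero; suc; _+_; _*_; _∸_; _%_; _<_; _≤_; _<?_; NonZero)
open import Data.Nat.DivMod using (_mod_; %-distribˡ-+; m%n%n≡m%n; [m+n]%n≡m%n; m<n⇒m%n≡m)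
open import Data.Nat.Properties
  using (+-assoc; +-comm; +-identityʳ; +-suc; *-suc; m+[n∸m]≡n; <⇒≤; ≮⇒≥; +-cancelˡ-<;
         +-monoˡ-≤; +-commutativeSemigroup; module ≤-Reasoning)
open import Algebra.Properties.CommutativeSemigroup +-commutativeSemigroup using (xy∙z≈xz∙y)
open import Data.Product using (∃-syntax; ∃₂; _×_; _,_; proj₁; proj₂; uncurry)
open import Data.Sum using (inj₁; inj₂)
open import Function using (_∘_; id)
open import Function.Definitions using (Injective)
open import Relation.Binary.Definitions using (DecidableEquality)
open import Relation.Binary.PropositionalEquality
open import Relation.Nullary using (¬_; yes; no)
open import Relation.Unary using (Decidable)
open import Relation.Unary.Properties using (∁?)

open import Defs

[m%n+o]%n≡[m+o]%n : ∀ m o n .{{_ : NonZero n}} → (m % n + o) % n ≡ (m + o) % n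
[m%n+o]%n≡[m+o]%n m o n = begin
  (m % n + o) % n          ≡⟨ %-distribˡ-+ (m % n) o n ⟩
  (m % n % n + o % n) % n  ≡⟨ cong (λ t → (t + o % n) % n) (m%n%n≡m%n m n) ⟩
  (m % n + o % n) % n      ≡⟨ %-distribˡ-+ m o n ⟨
  (m + o) % n              ∎
  where open ≡-Reasoning

[o+m+[n∸m]]%n≡o : ∀ {m o n} .{{_ : NonZero n}} → m ≤ n → o < n → (o + m + (n ∸ m)) % n ≡ o
[o+m+[n∸m]]%n≡o {m} {o} {n} m≤n o<n = begin
  (o + m + (n ∸ m)) % n    ≡⟨ cong (_% n) (+-assoc o m (n ∸ m)) ⟩
  (o + (m + (n ∸ m))) % n  ≡⟨ cong (λ t → (o + t) % n) (m+[n∸m]≡n m≤n) ⟩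
  (o + n) % n              ≡⟨ [m+n]%n≡m%n o n ⟩
  o % n                    ≡⟨ m<n⇒m%n≡m o<n ⟩
  o                        ∎
  where open ≡-Reasoning

[m+[o+[n∸m]]%n]%n≡o : ∀ {m o n} .{{_ : NonZero n}} → m ≤ n → o < n →
                      (m + (o + (n ∸ m)) % n) % n ≡ o
[m+[o+[n∸m]]%n]%n≡o {m} {o} {n} m≤n o<n = begin
  (m + (o + (n ∸ m)) % n) % n  ≡⟨ cong (_% n) (+-comm m _) ⟩
  ((o + (n ∸ m)) % n + m) % n  ≡⟨ [m%n+o]%n≡[m+o]%n (o + (n ∸ m)) m n ⟩
  (o + (n ∸ m) + m) % n        ≡⟨ cong (_% n) (xy∙z≈xz∙y o (n ∸ m) m) ⟩
  (o + m + (n ∸ m)) % n        ≡⟨ [o+m+[n∸m]]%n≡o m≤n o<n ⟩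
  o                            ∎
  where open ≡-Reasoning

[[o+m]%n+[n∸m]]%n≡o : ∀ {m o n} .{{_ : NonZero n}} → m ≤ n → o < n →
                      ((o + m) % n + (n ∸ m)) % n ≡ o
[[o+m]%n+[n∸m]]%n≡o {m} {o} {n} m≤n o<n =
  trans ([m%n+o]%n≡[m+o]%n (o + m) (n ∸ m) n) ([o+m+[n∸m]]%n≡o m≤n o<n)

toℕ-mod : ∀ m n .{{_ : NonZero n}} → toℕ (m mod n) ≡ m % n
toℕ-mod m n = toℕ-fromℕ< _

pigeonhole² : ∀ {a b m} → m < a * b → (f : Fin a → Fin b → Fin m) →
              ∃₂ λ x y → x ≢ y × uncurry f x ≡ uncurry f y
pigeonhole² {a} {b} m<ab f with i , j , i<j , fi≡fj ← pigeonhole m<ab (uncurry f ∘ remQuot b) =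
  remQuot b i , remQuot b j , <⇒≢ i<j ∘ remQuot-injective , fi≡fj
  where
  remQuot-injective : remQuot b i ≡ remQuot b j → i ≡ j
  remQuot-injective e = trans (sym (combine-remQuot {a} b i))
                              (trans (cong (uncurry combine) e) (combine-remQuot {a} b j))

length-filter+length-filter-∁ : ∀ {A : Set} {P : A → Set} (P? : Decidable P) xs →
  length (filter P? xs) + length (filter (∁? P?) xs) ≡ length xs
length-filter+length-filter-∁ P? [] = refl
length-filter+length-filter-∁ P? (x ∷ xs) with P? x
... | yes _ = cong suc (length-filter+length-filter-∁ P? xs)
... | no _ = trans (+-suc _ _) (cong suc (length-filter+length-filter-∁ P? xs))

Unique-lookup-injective : ∀ {A : Set} {xs : List A} → Unique xs →
                          ∀ {i j} → lookup xs i ≡ lookup xs j → i ≡ j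
Unique-lookup-injective (x∉ ∷ u) {zero} {zero} _ = refl
Unique-lookup-injective (x∉ ∷ u) {zero} {suc j} e = ⊥-elim (All.lookup x∉ (∈-lookup j) e)
Unique-lookup-injective (x∉ ∷ u) {suc i} {zero} e = ⊥-elim (All.lookup x∉ (∈-lookup i) (sym e))
Unique-lookup-injective (x∉ ∷ u) {suc i} {suc j} e = cong suc (Unique-lookup-injective u e)

module _ {A B : Set} (_≟ᴮ_ : DecidableEquality B) (f : A → B) where

  private
    fibre? : (b : B) → Decidable (λ x → f x ≡ b)
    fibre? b x = f x ≟ᴮ b

  large-fibre : ∀ a (bs : List B) (xs : List A) → Unique xs → All (λ x → f x ∈ bs) xs →
                a * length bs < length xs →
                ∃₂ λ b ys → Unique ys × All (λ y → f y ≡ b) ys × a < length ys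
  large-fibre a [] [] _ _ ()
  large-fibre a [] (x ∷ xs) _ (() ∷ _) _
  large-fibre a (b ∷ bs) xs u f∈bs lt with a <? length (filter (fibre? b) xs)
  ... | yes large = b , _ , Unique.filter⁺ (fibre? b) u , all-filter (fibre? b) xs , large
  ... | no small = large-fibre a bs rest (Unique.filter⁺ (∁? (fibre? b)) u) rest∈bs rest-large
    where
    rest = filter (∁? (fibre? b)) xs
    rest∈bs : All (λ x → f x ∈ bs) rest
    rest∈bs = All.zipWith (uncurry Any.tail)
                (all-filter (∁? (fibre? b)) xs , filter⁺ (∁? (fibre? b)) f∈bs)
    rest-large : a * length bs < length rest
    rest-large = +-cancelˡ-< a _ _ (begin-strict
      a + a * length bs                           ≡⟨ *-suc a (length bs) ⟨
      a * suc (length bs)                         <⟨ lt ⟩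
      length xs                                   ≡⟨ length-filter+length-filter-∁ (fibre? b) xs ⟨
      length (filter (fibre? b) xs) + length rest ≤⟨ +-monoˡ-≤ (length rest) (≮⇒≥ small) ⟩
      a + length rest                             ∎)
      where open ≤-Reasoning

largeColourClass : ∀ {n k} (f : Fin n → Fin k) a → a * k < n →
                   ∃₂ λ α (g : Fin (suc a) → Fin n) → Injective _≡_ _≡_ g × (∀ i → f (g i) ≡ α)
largeColourClass {n} {k} f a a*k<n
  with α , ys , u , ys-α , a<|ys| ← large-fibre _≟_ f a (allFin k) (allFin n)
         (Unique.allFin⁺ n) (All.tabulate λ _ → ∈-allFin _)
         (subst₂ (λ l l′ → a * l < l′) (sym (length-tabulate {n = k} id))
                                       (sym (length-tabulate {n = n} id)) a*k<n) =
  α , g , (inject≤-injective a<|ys| a<|ys| _ _ ∘ Unique-lookup-injective u) ,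
  (λ i → All.lookup ys-α (∈-lookup (inject≤ i a<|ys|)))
  where
  g : Fin (suc a) → Fin n
  g i = lookup ys (inject≤ i a<|ys|)

-- What the argument needs from either direction of the shift pattern.
record ColumnTransport {m k : ℕ} (χ : Coloring (suc m) k) : Set where
  field
    column : Fin (suc m) → Fin (suc m) → Fin (suc m)
    colour-column : ∀ r s → χ r s ≡ χ zero (column r s)
    column-zero : ∀ s → column zero s ≡ s
    transitive : ∀ s t → ∃[ r ] column r s ≡ t

module _ {m k : ℕ} {χ : Coloring (suc m) k} where

  rightShift⇒transport : RightShift χ → ColumnTransport χ
  rightShift⇒transport shift = record
    { column = column
    ; colour-column = λ r s → shift r s zero (column r s) refl (toℕ-column r s)
    ; column-zero = λ s → toℕ-injective (begin
        toℕ (column zero s)  ≡⟨ toℕ-column zero s ⟩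
        (toℕ s + n) % n      ≡⟨ [m+n]%n≡m%n (toℕ s) n ⟩
        toℕ s % n            ≡⟨ m<n⇒m%n≡m (toℕ<n s) ⟩
        toℕ s                ∎)
    ; transitive = transitive
    }
    where
    open ≡-Reasoning
    n = suc m
    column : Fin n → Fin n → Fin n
    column r s = (toℕ s + (n ∸ toℕ r)) mod n
    toℕ-column : ∀ r s → toℕ (column r s) ≡ (toℕ s + (n ∸ toℕ r)) % n
    toℕ-column r s = toℕ-mod (toℕ s + (n ∸ toℕ r)) n
    transitive : ∀ s t → ∃[ r ] column r s ≡ t
    transitive s t = r , toℕ-injective (begin
      toℕ (column r s)                 ≡⟨ toℕ-column r s ⟩
      (toℕ s + (n ∸ toℕ r)) % n        ≡⟨ cong (λ x → (x + (n ∸ toℕ r)) % n) t+r≡s ⟨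
      ((toℕ t + toℕ r) % n + (n ∸ toℕ r)) % n
                                       ≡⟨ [[o+m]%n+[n∸m]]%n≡o (<⇒≤ (toℕ<n r)) (toℕ<n t) ⟩
      toℕ t                            ∎)
      where
      -- r ≡ s − t (mod n), so shifting t left by r gives s.
      r = (toℕ s + (n ∸ toℕ t)) mod n
      t+r≡s : (toℕ t + toℕ r) % n ≡ toℕ s
      t+r≡s = trans (cong (λ x → (toℕ t + x) % n) (toℕ-mod (toℕ s + (n ∸ toℕ t)) n))
                    ([m+[o+[n∸m]]%n]%n≡o (<⇒≤ (toℕ<n t)) (toℕ<n s))

  leftShift⇒transport : LeftShift χ → ColumnTransport χ
  leftShift⇒transport shift = record
    { column = column
    ; colour-column = λ r s → shift r s zero (column r s) refl (toℕ-column r s)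
    ; column-zero = λ s → toℕ-injective (begin
        toℕ (column zero s)  ≡⟨ toℕ-column zero s ⟩
        (toℕ s + 0) % n      ≡⟨ cong (_% n) (+-identityʳ (toℕ s)) ⟩
        toℕ s % n            ≡⟨ m<n⇒m%n≡m (toℕ<n s) ⟩
        toℕ s                ∎)
    ; transitive = transitive
    }
    where
    open ≡-Reasoning
    n = suc m
    column : Fin n → Fin n → Fin n
    column r s = (toℕ s + toℕ r) mod n
    toℕ-column : ∀ r s → toℕ (column r s) ≡ (toℕ s + toℕ r) % n
    toℕ-column r s = toℕ-mod (toℕ s + toℕ r) n
    transitive : ∀ s t → ∃[ r ] column r s ≡ t
    transitive s t = r , toℕ-injective (begin
      toℕ (column r s)                         ≡⟨ toℕ-column r s ⟩
      (toℕ s + toℕ r) % n                      ≡⟨ cong (λ x → (toℕ s + x) % n) (toℕ-mod (toℕ t + (n ∸ toℕ s)) n) ⟩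
      (toℕ s + (toℕ t + (n ∸ toℕ s)) % n) % n  ≡⟨ [m+[o+[n∸m]]%n]%n≡o (<⇒≤ (toℕ<n s)) (toℕ<n t) ⟩
      toℕ t                                    ∎)
      where
      r = (toℕ t + (n ∸ toℕ s)) mod n

  shiftPattern⇒transport : HasShiftPattern χ → ColumnTransport χ
  shiftPattern⇒transport (inj₁ right) = rightShift⇒transport right
  shiftPattern⇒transport (inj₂ left) = leftShift⇒transport left

module _ {m k : ℕ} {χ : Coloring (suc m) k} (T : ColumnTransport χ)
         {a : ℕ} {α : Fin k} {g : Fin (suc a) → Fin (suc m)}
         (g-injective : Injective _≡_ _≡_ g) (g-colour : ∀ i → χ zero (g i) ≡ α) where

  open ColumnTransport T

  private
    carrier : Fin (suc a) → Fin a → Fin (suc m)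
    carrier p q = proj₁ (transitive (g p) (g (punchIn p q)))

    column-carrier : ∀ p q → column (carrier p q) (g p) ≡ g (punchIn p q)
    column-carrier p q = proj₂ (transitive (g p) (g (punchIn p q)))

    zero≢carrier : ∀ p q → zero ≢ carrier p q
    zero≢carrier p q 0≡c = punchInᵢ≢i p q (g-injective (begin
      g (punchIn p q)            ≡⟨ column-carrier p q ⟨
      column (carrier p q) (g p) ≡⟨ cong (λ r → column r (g p)) 0≡c ⟨
      column zero (g p)          ≡⟨ column-zero (g p) ⟩
      g p                        ∎))
      where open ≡-Reasoning

    carrier-injectiveʳ : ∀ p {q q′} → carrier p q ≡ carrier p q′ → q ≡ q′
    carrier-injectiveʳ p {q} {q′} c≡c′ = punchIn-injective p q q′ (g-injective (begin
      g (punchIn p q)             ≡⟨ column-carrier p q ⟨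
      column (carrier p q) (g p)  ≡⟨ cong (λ r → column r (g p)) c≡c′ ⟩
      column (carrier p q′) (g p) ≡⟨ column-carrier p q′ ⟩
      g (punchIn p q′)            ∎))
      where open ≡-Reasoning

    colour-carrier : ∀ p q → χ (carrier p q) (g p) ≡ α
    colour-carrier p q = trans (colour-column _ _)
                               (trans (cong (χ zero) (column-carrier p q)) (g-colour _))

    rectangle : ∀ {p p′ q q′} → p ≢ p′ → carrier p q ≡ carrier p′ q′ → HasMonoRectangle χ
    rectangle {p} {p′} {q} {q′} p≢p′ c≡c′ =
      zero , g p , carrier p q , g p′ , zero≢carrier p q , p≢p′ ∘ g-injective ,
      trans (g-colour p) (sym (g-colour p′)) ,
      trans (g-colour p) (sym (colour-carrier p q)) ,
      trans (g-colour p) (sym (subst (λ r → χ r (g p′) ≡ α) (sym c≡c′) (colour-carrier p′ q′)))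

    carriers-equal : ∀ {p p′ q q′} → punchOut (zero≢carrier p q) ≡ punchOut (zero≢carrier p′ q′) →
                     carrier p q ≡ carrier p′ q′
    carriers-equal {p} {p′} {q} {q′} = punchOut-injective (zero≢carrier p q) (zero≢carrier p′ q′)

  monoRectangle : m < suc a * a → HasMonoRectangle χ
  monoRectangle m<pairs
    with (p , q) , (p′ , q′) , pq≢p′q′ , same ← pigeonhole² m<pairs (λ p q → punchOut (zero≢carrier p q))
    with p ≟ p′
  ... | yes refl = ⊥-elim (pq≢p′q′ (cong (p ,_) (carrier-injectiveʳ p (carriers-equal same))))
  ... | no p≢p′ = rectangle p≢p′ (carriers-equal same)

proposition3 : (k n : ℕ) → 0 < k → k * k < n → n < k * k + k →
    ¬ (∃[ χ ] (¬ HasMonoRectangle {n} {k} χ × HasShiftPattern χ))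
-- The hypothesis 0 < k is implied by k * k < n < k * k + k.
proposition3 k zero _ () _
proposition3 k (suc m) _ k*k<n n<k*k+k (χ , noRectangle , shift)
  with α , g , g-injective , g-colour ← largeColourClass (χ zero) k k*k<n =
  noRectangle (monoRectangle (shiftPattern⇒transport shift) g-injective g-colour m<pairs)
  where
  m<pairs : m < suc k * k
  m<pairs = subst (m <_) (+-comm (k * k) k) (<⇒≤ n<k*k+k)
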